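{- Let $m\subseteq\{a\}^*\times\{a,b,\#\}^*$ be the relation $\{(a^n,w\#w)\mid n\ge0,\ w\in\{a,b\}^*,\ |w|=n\}$. Then $m$ is not realized by any (nondeterministic) two-way generalized sequential machine, i.e. $m\notin\mathrm{NGSM}$.
   Context: 2gsm: $M=(Q,\Sigma_1,\Sigma_2,\delta,q_{in},q_f)$ with finite state set $Q$ and instructions $(p,\sigma,q_1,\alpha_1,\epsilon_1,q_0,\alpha_0,\epsilon_0)$, $p\ne q_f$, $\sigma\in\Sigma_1\cup\{\vdash,\dashv\}$, $\alpha_i\in\Sigma_2^*$, $\epsilon_i\in\{ -1,0,+1\}$; on input $w$ the read-only tape holds $\vdash w\dashv$ in positions $0,\dots,|w|+1$; in state $p$ scanning $\tau$, any instruction starting with $p$ may be executed: enter $q_1$, append $\alpha_1$ to the one-way output tape and move by $\epsilon_1$ if $\tau=\sigma$, otherwise use $(q_0,\alpha_0,\epsilon_0)$; $(w,z)$ is realized iff some computation starting in $q_{in}$ at position $0$ reaches $q_f$ with output $z$. $\mathrm{NGSM}$ is the family of transductions realized by 2gsm's. -}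

module Defs where

open import Data.Nat using (ℕ; zero; suc; _+_)
open import Data.Fin using (Fin)
open import Data.List using (List; []; _∷_; _++_; length; lookup)
open import Data.List.Membership.Propositional using (_∈_)
open import Data.Product using (_×_; _,_; ∃-syntax)
open import Relation.Binary.PropositionalEquality using (_≡_; _≢_)
open import Relation.Nullary using (¬_)

-- Tape symbols of the input tape: ⊢ w ⊣
data TapeSym (Σ₁ : Set) : Set where
  ⊢ ⊣ : TapeSym Σ₁
  sym : Σ₁ → TapeSym Σ₁

data Move : Set where
  left stay right : Move

-- apply a move to a position; moving left from 0 is impossible
move : Move → ℕ → ℕ → Set
move left  i j = suc j ≡ i
move stay  i j = j ≡ i
move right i j = j ≡ suc i

-- symbol at position i of ⊢ w ⊣ (positions 0 .. |w|+1)
data At {Σ₁ : Set} : List Σ₁ → ℕ → TapeSym Σ₁ → Set where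
  at-⊢   : ∀ {w} → At w 0 ⊢
  at-sym : ∀ {w i} (k : Data.Fin.Fin (length w)) → Data.Fin.toℕ k ≡ i →
           At w (suc i) (sym (lookup w k))
  at-⊣   : ∀ {w} → At w (suc (length w)) ⊣

-- instruction (p, σ, q₁, α₁, ε₁, q₀, α₀, ε₀) over states Fin nQ, with p ≠ qf
record Instr (Σ₁ Σ₂ : Set) (nQ : ℕ) (qf : Fin nQ) : Set where
  field
    p    : Fin nQ
    p≢qf : p ≢ qf
    σ    : TapeSym Σ₁
    q₁   : Fin nQ
    α₁   : List Σ₂
    ε₁   : Move
    q₀   : Fin nQ
    α₀   : List Σ₂
    ε₀   : Move

record TwoGSM (Σ₁ Σ₂ : Set) : Set where
  field
    nQ     : ℕ
    qin qf : Fin nQ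
    δ      : List (Instr Σ₁ Σ₂ nQ qf)

module _ {Σ₁ Σ₂ : Set} (M : TwoGSM Σ₁ Σ₂) where
  open TwoGSM M
  private Ins = Instr Σ₁ Σ₂ nQ qf

  -- configuration: state, head position, output written so far
  Config : Set
  Config = Fin nQ × ℕ × List Σ₂

  data Step (w : List Σ₁) : Config → Config → Set where
    step-eq  : ∀ {i j z τ} (ins : Ins) → ins ∈ δ → At w i τ →
               τ ≡ Instr.σ ins → move (Instr.ε₁ ins) i j →
               Step w (Instr.p ins , i , z) (Instr.q₁ ins , j , z ++ Instr.α₁ ins)
    step-neq : ∀ {i j z τ} (ins : Ins) → ins ∈ δ → At w i τ →
               τ ≢ Instr.σ ins → move (Instr.ε₀ ins) i j →
               Step w (Instr.p ins , i , z) (Instr.q₀ ins , j , z ++ Instr.α₀ ins)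

  data Steps (w : List Σ₁) : Config → Config → Set where
    done : ∀ {c} → Steps w c c
    _▸_  : ∀ {c d e} → Step w c d → Steps w d e → Steps w c e

  Realizes : List Σ₁ → List Σ₂ → Set
  Realizes w z = ∃[ i ] Steps w (qin , 0 , []) (qf , i , z)

Realized : {Σ₁ Σ₂ : Set} → TwoGSM Σ₁ Σ₂ → (List Σ₁ → List Σ₂ → Set) → Set
Realized M R = ∀ w z → (Realizes M w z → R w z) × (R w z → Realizes M w z)

InNGSM : {Σ₁ Σ₂ : Set} → (List Σ₁ → List Σ₂ → Set) → Set
InNGSM {Σ₁} {Σ₂} R = ∃[ M ] Realized {Σ₁} {Σ₂} M R

data A : Set where
  a : A

data B : Set where
  a b # : B

data AB : Set where
  a b : AB

ι : AB → B
ι a = B.a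
ι b = B.b

m : List A → List B → Set
m u z = ∃[ w ] (length w ≡ length u) ×
        (z ≡ Data.List.map ι w ++ (B.# ∷ Data.List.map ι w))

{-# OPTIONS --safe #-}
module Submission where

-- Suppose a 2gsm M realizes m. On input aⁿ, an accepting run with output w # w writes its first #
-- in a single step, whose label (head position, instruction, and whether the scanned symbol matched
-- the instruction's test) takes at most (n + 2) · |δ| · 2 values. A run segment appends the same
-- output whatever was written before it, so two such runs whose #-steps carry the same label can be
-- spliced: the first one up to its #-step, then the rest of the second. The spliced run outputs
-- w₁ # w₂, which lies in m only if w₁ = w₂. Hence the label is injective on {a,b}ⁿ, and
-- 2ⁿ ≤ (n + 2) · |δ| · 2, which fails for large n.

open import Defs hiding (sym)
open import Relation.Nullary using (¬_)

open import Data.Bool using (Bool; true; false)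
open import Data.Empty using (⊥-elim)
open import Data.Fin using (Fin; zero; suc; toℕ; fromℕ; inject₁; quotient; remainder)
open import Data.Fin.Properties using (toℕ-fromℕ; toℕ-inject₁; *↔×; 2↔Bool; injective⇒≤)
open import Data.List using (List; []; _∷_; _++_; length; lookup; map; replicate)
open import Data.List.Properties
  using (++-assoc; ++-identityʳ; ∷-injective; map-injective; length-replicate)
open import Data.List.Relation.Unary.All as All using (All; []; _∷_)
open import Data.List.Relation.Unary.All.Properties using (++⁺; ++⁻ʳ; map⁺)
open import Data.List.Relation.Unary.Any using (index)
open import Data.List.Relation.Unary.Any.Properties using (lookup-index)
import Data.List.Relation.Unary.First as First
open import Data.List.Relation.Unary.First.Properties using (toView)
open import Data.Nat using (ℕ; zero; suc; _+_; _*_; _^_; _<_; _≤_; s≤s; z≤n)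
open import Data.Nat.Properties
  using (suc-injective; <⇒≱; ≤-trans; m≤m+n; +-mono-≤; *-mono-≤; *-monoʳ-≤; m^n>0; ^-distribˡ-+-*; module ≤-Reasoning)
open import Data.Nat.Tactic.RingSolver using (solve-∀)
open import Data.Product using (Σ-syntax; ∃-syntax; _×_; _,_; -,_; proj₁; proj₂)
open import Data.Product.Function.NonDependent.Propositional using (_×-↔_)
open import Data.Sum as Sum using (_⊎_; inj₁; inj₂)
open import Function using (Injective; Injection; _↔_)
open import Function.Properties.Inverse using (↔-refl; ↔-sym; ↔-trans; Inverse⇒Injection)
open import Relation.Binary.PropositionalEquality using (_≡_; _≢_; refl; sym; trans; cong; cong₂; subst)

Hashless : List B → Set
Hashless = All (_≢ #)

#-split-unique : ∀ {P P′ S S′} → Hashless P → Hashless P′ →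
                 P ++ # ∷ S ≡ P′ ++ # ∷ S′ → P ≡ P′ × S ≡ S′
#-split-unique []         []          refl = refl , refl
#-split-unique []         (#≢# ∷ _)   refl = ⊥-elim (#≢# refl)
#-split-unique (#≢# ∷ _)  []          refl = ⊥-elim (#≢# refl)
#-split-unique (_ ∷ P-free) (_ ∷ P′-free) eq
  with refl , eq′ ← ∷-injective eq
  with refl , refl ← #-split-unique P-free P′-free eq′
  = refl , refl

++-regroup : ∀ {X : Set} (o x : List X) c y t → (o ++ x ++ c ∷ y) ++ t ≡ (o ++ x) ++ c ∷ y ++ t
++-regroup o x c y t =
  trans (++-assoc o _ t) (trans (cong (o ++_) (++-assoc x (c ∷ y) t)) (sym (++-assoc o x _)))

≢#⊎≡# : (c : B) → c ≢ # ⊎ c ≡ #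
≢#⊎≡# a = inj₁ λ ()
≢#⊎≡# b = inj₁ λ ()
≢#⊎≡# # = inj₂ refl

first-# : (α : List B) → First.FirstView (_≢ #) (_≡ #) α ⊎ Hashless α
first-# α = Sum.map₁ toView (First.first ≢#⊎≡# α)

move-deterministic : ∀ ε {i j j′} → move ε i j → move ε i j′ → j ≡ j′
move-deterministic left  i≡1+j i≡1+j′ = suc-injective (trans i≡1+j (sym i≡1+j′))
move-deterministic stay  j≡i  j′≡i    = trans j≡i (sym j′≡i)
move-deterministic right j≡1+i j′≡1+i = trans j≡1+i (sym j′≡1+i)

At-position : ∀ {Σ₁} {w : List Σ₁} {i τ} → At w i τ →
              Σ[ pos ∈ Fin (suc (suc (length w))) ] toℕ pos ≡ i
At-position at-⊢                = zero , refl
At-position (at-sym k refl)     = suc (inject₁ k) , cong suc (toℕ-inject₁ k)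
At-position {w = w} at-⊣        = fromℕ (suc (length w)) , toℕ-fromℕ _

module HashCuts {Σ₁ : Set} (M : TwoGSM Σ₁ B) where
  open TwoGSM M

  private
    Ins = Instr Σ₁ B nQ qf
    variable
      w : List Σ₁
      c d e : Config M
      s s′ : Fin nQ
      i i′ n : ℕ
      z z′ P S : List B

  _◅◅_ : Steps M w c d → Steps M w d e → Steps M w c e
  done       ◅◅ r = r
  (st ▸ rest) ◅◅ r = st ▸ (rest ◅◅ r)

  step-appends : Step M w (s , i , z) (s′ , i′ , z′) →
                 ∃[ α ] z′ ≡ z ++ α × (∀ z₀ → Step M w (s , i , z₀) (s′ , i′ , z₀ ++ α))
  step-appends (step-eq  ins ins∈δ at τ≡σ mv) = -, refl , λ _ → step-eq  ins ins∈δ at τ≡σ mv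
  step-appends (step-neq ins ins∈δ at τ≢σ mv) = -, refl , λ _ → step-neq ins ins∈δ at τ≢σ mv

  steps-append : Steps M w (s , i , z) (s′ , i′ , z′) →
                 ∃[ t ] z′ ≡ z ++ t × (∀ z₀ → Steps M w (s , i , z₀) (s′ , i′ , z₀ ++ t))
  steps-append {w = w} {s = s} {i = i} {z = z} done =
    [] , sym (++-identityʳ z) ,
    λ z₀ → subst (λ z₁ → Steps M w (s , i , z₀) (s , i , z₁)) (sym (++-identityʳ z₀)) done
  steps-append {w = w} {z = z} (st ▸ rest) with step-appends st | steps-append rest
  ... | α , refl , st′ | t , refl , rest′ =
    α ++ t , ++-assoc z α t ,
    λ z₀ → st′ z₀ ▸ subst (λ z₁ → Steps M w _ (_ , _ , z₁)) (++-assoc z₀ α t) (rest′ (z₀ ++ α))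

  target : Ins → Bool → Fin nQ
  target ins true  = Instr.q₁ ins
  target ins false = Instr.q₀ ins

  emitted : Ins → Bool → List B
  emitted ins true  = Instr.α₁ ins
  emitted ins false = Instr.α₀ ins

  head-move : Ins → Bool → Move
  head-move ins true  = Instr.ε₁ ins
  head-move ins false = Instr.ε₀ ins

  Label : List Σ₁ → Set
  Label w = Fin (suc (suc (length w))) × Fin (length δ) × Bool

  data Fires (w : List Σ₁) : Label w → Fin nQ → ℕ → List B → Set where
    fires : ∀ {pos idx matched ins j} → lookup δ idx ≡ ins →
            move (head-move ins matched) (toℕ pos) j →
            Fires w (pos , idx , matched) (target ins matched) j (emitted ins matched)

  fires-deterministic : ∀ {ℓ : Label w} {q q′ j j′ α α′} →
                        Fires w ℓ q j α → Fires w ℓ q′ j′ α′ → q ≡ q′ × j ≡ j′ × α ≡ α′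
  fires-deterministic {ℓ = _ , idx , matched} (fires refl mv) (fires refl mv′) =
    refl , move-deterministic (head-move (lookup δ idx) matched) mv mv′ , refl

  step-fires : Step M w (s , i , z) (s′ , i′ , z′) →
               Σ[ ℓ ∈ Label w ] ∃[ α ] z′ ≡ z ++ α × Fires w ℓ s′ i′ α
  step-fires (step-eq ins ins∈δ at _ mv) with At-position at
  ... | pos , refl = (pos , index ins∈δ , true) , -, refl , fires (sym (lookup-index ins∈δ)) mv
  step-fires (step-neq ins ins∈δ at _ mv) with At-position at
  ... | pos , refl = (pos , index ins∈δ , false) , -, refl , fires (sym (lookup-index ins∈δ)) mv

  start : Config M
  start = qin , 0 , []

  -- The step of an accepting run that writes its first # has label `label` and output
  -- x ++ # ∷ y, and leaves M in (q , j).
  record HashCut (w : List Σ₁) (P S : List B) : Set where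
    field
      label  : Label w
      q      : Fin nQ
      j k    : ℕ
      x y t  : List B
      fired  : Fires w label q j (x ++ # ∷ y)
      x-free : Hashless x
      before : Steps M w start (q , j , P ++ # ∷ y)
      after  : ∀ o → Steps M w (q , j , o) (qf , k , o ++ t)
      S≡y++t : S ≡ y ++ t

  locate-first-# : Steps M w start (s , i , z) → Hashless z →
                   Steps M w (s , i , z) (qf , n , P ++ # ∷ S) → Hashless P → HashCut w P S
  locate-first-# {P = P} _ z-free done _ with #≢# ∷ _ ← ++⁻ʳ P z-free = ⊥-elim (#≢# refl)
  locate-first-# {z = z} {P = P} prefix z-free (st ▸ rest) P-free with step-fires st
  ... | ℓ , α , refl , fired with first-# α
  ...   | inj₂ α-free = locate-first-# (prefix ◅◅ (st ▸ done)) (++⁺ z-free α-free) rest P-free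
  ...   | inj₁ (First._++_∷_ {xs = x} x-free refl y) with steps-append rest
  ...     | t , out≡ , after
          with refl , refl ← #-split-unique P-free (++⁺ z-free x-free)
                                            (trans out≡ (++-regroup z x # y t)) =
    record { label = ℓ ; fired = fired ; x-free = x-free
           ; before = subst (λ o → Steps M _ start (_ , _ , o)) (sym (++-assoc z x (# ∷ y)))
                            (prefix ◅◅ (st ▸ done))
           ; after = after ; S≡y++t = refl }

  hash-cut : Realizes M w (P ++ # ∷ S) → Hashless P → HashCut w P S
  hash-cut (_ , run) = locate-first-# done [] run

  splice : ∀ {P₁ S₁ P₂ S₂} (c₁ : HashCut w P₁ S₁) (c₂ : HashCut w P₂ S₂) →
           HashCut.label c₁ ≡ HashCut.label c₂ → Realizes M w (P₁ ++ # ∷ S₂)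
  splice {P₁ = P₁}
         record { label = ℓ ; y = y₁ ; fired = fired₁ ; x-free = x₁-free ; before = before₁ }
         record { label = .ℓ ; k = k₂ ; t = t₂ ; fired = fired₂ ; x-free = x₂-free
                ; after = after₂ ; S≡y++t = refl }
         refl
    with refl , refl , α≡ ← fires-deterministic fired₁ fired₂
    with refl , refl ← #-split-unique x₁-free x₂-free α≡
    = k₂ , subst (λ o → Steps M _ start (qf , k₂ , o)) (++-assoc P₁ (# ∷ y₁) t₂) (before₁ ◅◅ after₂ _)

letter : Fin 2 → AB
letter zero       = a
letter (suc zero) = b

letter-injective : Injective _≡_ _≡_ letter
letter-injective {zero}     {zero}     _ = refl
letter-injective {suc zero} {suc zero} _ = refl
letter-injective {zero}     {suc zero} ()
letter-injective {suc zero} {zero}     ()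

word : ∀ n → Fin (2 ^ n) → List AB
word zero    _ = []
word (suc n) k = letter (quotient (2 ^ n) k) ∷ word n (remainder {2} (2 ^ n) k)

word-length : ∀ n k → length (word n k) ≡ n
word-length zero    _ = refl
word-length (suc n) k = cong suc (word-length n _)

word-injective : ∀ n → Injective _≡_ _≡_ (word n)
word-injective zero    {zero} {zero} _ = refl
word-injective (suc n) eq
  with letters≡ , rest≡ ← ∷-injective eq
  = Injection.injective (Inverse⇒Injection *↔×)
      (cong₂ _,_ (letter-injective letters≡) (word-injective n rest≡))

labels↔ : ∀ {a b} → Fin (a * (b * 2)) ↔ (Fin a × Fin b × Bool)
labels↔ = ↔-trans *↔× (↔-refl ×-↔ ↔-trans *↔× (↔-refl ×-↔ 2↔Bool))

injective-into-labels⇒≤ : ∀ {N a b} {f : Fin N → Fin a × Fin b × Bool} →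
                          Injective _≡_ _≡_ f → N ≤ a * (b * 2)
injective-into-labels⇒≤ f-injective =
  injective⇒≤ λ eq → f-injective (Injection.injective (Inverse⇒Injection (↔-sym labels↔)) eq)

n<2^n : ∀ n → n < 2 ^ n
n<2^n zero    = s≤s z≤n
n<2^n (suc n) = +-mono-≤ (m^n>0 2 n) (≤-trans (n<2^n n) (m≤m+n (2 ^ n) 0))

exponential-beats-linear : ∀ c → ∃[ n ] suc (suc n) * c < 2 ^ n
exponential-beats-linear c = k + k , (begin-strict
    suc (suc (k + k)) * c                                  <⟨ s≤s (m≤m+n _ _) ⟩
    suc (suc (suc (k + k)) * c + (2 * c * c + 4 * c + 3))  ≡⟨ square-excess c ⟩
    (2 * k) * (2 * k)                                      ≤⟨ *-mono-≤ 2k≤2^k 2k≤2^k ⟩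
    2 ^ k * 2 ^ k                                          ≡⟨ sym (^-distribˡ-+-* 2 k k) ⟩
    2 ^ (k + k)                                            ∎)
  where
  open ≤-Reasoning
  k : ℕ
  k = suc c
  2k≤2^k : 2 * k ≤ 2 ^ k
  2k≤2^k = *-monoʳ-≤ 2 (n<2^n c)
  square-excess : ∀ x → suc (suc (suc (suc x + suc x)) * x + (2 * x * x + 4 * x + 3))
                        ≡ (2 * suc x) * (2 * suc x)
  square-excess = solve-∀

ι-injective : Injective _≡_ _≡_ ι
ι-injective {AB.a} {AB.a} _ = refl
ι-injective {AB.b} {AB.b} _ = refl
ι-injective {AB.a} {AB.b} ()
ι-injective {AB.b} {AB.a} ()

map-ι-hashless : ∀ w → Hashless (map ι w)
map-ι-hashless w = map⁺ (All.universal (λ { AB.a () ; AB.b () }) w)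

m-halves-equal : ∀ {u w₁ w₂} → m u (map ι w₁ ++ # ∷ map ι w₂) → w₁ ≡ w₂
m-halves-equal {w₁ = w₁} (v , _ , eq)
  with w₁≡v , w₂≡v ← #-split-unique (map-ι-hashless w₁) (map-ι-hashless v) eq
  = map-injective ι-injective (trans w₁≡v (sym w₂≡v))

module _ (M : TwoGSM A B) (M-realizes-m : Realized M m) where
  open TwoGSM M using (δ)
  open HashCuts M

  input : ℕ → List A
  input n = replicate n A.a

  cut : ∀ n (k : Fin (2 ^ n)) → HashCut (input n) (map ι (word n k)) (map ι (word n k))
  cut n k = hash-cut (proj₂ (M-realizes-m (input n) _) (word n k , |word|≡|input| , refl))
                     (map-ι-hashless (word n k))
    where
    |word|≡|input| : length (word n k) ≡ length (input n)
    |word|≡|input| = trans (word-length n k) (sym (length-replicate n))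

  cut-label-injective : ∀ n → Injective _≡_ _≡_ (λ k → HashCut.label (cut n k))
  cut-label-injective n {k₁} {k₂} same-label =
    word-injective n (m-halves-equal {u = input n}
      (proj₁ (M-realizes-m (input n) _) (splice (cut n k₁) (cut n k₂) same-label)))

  2^n≤labels : ∀ n → 2 ^ n ≤ suc (suc n) * (length δ * 2)
  2^n≤labels n = subst (λ ℓ → 2 ^ n ≤ suc (suc ℓ) * (length δ * 2)) (length-replicate n {x = A.a})
                       (injective-into-labels⇒≤ (cut-label-injective n))

lemma5p2 : ¬ InNGSM m
lemma5p2 (M , M-realizes-m) =
  let n , labels<2^n = exponential-beats-linear (length (TwoGSM.δ M) * 2)
  in <⇒≱ labels<2^n (2^n≤labels M M-realizes-m n)
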